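{- For every integer $s\geq 1$, $$\sum_{n_1\geq\cdots\geq n_s\geq n_{s+1}\geq 2}\frac{1}{n_1(n_1-1)\cdots n_s(n_s-1)\,n_{s+1}}\leq\frac{1}{2^{s+1}}\prod_{l\geq 3}\frac{1}{1-\frac{2}{l(l-1)}}+\zeta^{\star}(\{2\}^s,1)-\zeta^{\star}(\{2\}^s).$$
   Context: $\zeta^{\star}(k_1,\dots,k_r)=\sum_{n_1\geq\cdots\geq n_r\geq 1}\frac{1}{n_1^{k_1}\cdots n_r^{k_r}}$; $\{2\}^s$ denotes $2$ repeated $s$ times. -}

module Defs where

open import Data.Nat as ℕ using (ℕ; zero; suc; _∸_)
open import Data.Integer using (+_)
open import Data.Rational using (ℚ; 0ℚ; 1ℚ; _+_; _*_; _-_; _/_; 1/_; ≢-nonZero)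
open import Data.Rational.Properties using (_≟_)
open import Data.List using (List; []; _∷_; map; upTo; foldr; replicate; _++_)
open import Relation.Nullary using (yes; no)

-- reciprocal of a natural number as a rational; the value at 0 is a
-- dummy (0) and is never used below (all summation indices are ≥ 1)
inv : ℕ → ℚ
inv zero    = 0ℚ
inv (suc k) = + 1 / suc k

-- reciprocal of a rational; dummy value 0 at 0 (never used below)
invQ : ℚ → ℚ
invQ p with p ≟ 0ℚ
... | yes _  = 0ℚ
... | no p≢0 = 1/_ p {{≢-nonZero p≢0}}

range : ℕ → ℕ → List ℕ
range lo ub = map (lo ℕ.+_) (upTo (suc ub ∸ lo))

sumQ : List ℚ → ℚ
sumQ = foldr _+_ 0ℚ

prodQ : List ℚ → ℚ
prodQ = foldr _*_ 1ℚ

-- nested sum over chains  ub ≥ n₁ ≥ n₂ ≥ ... ≥ n_r ≥ lo  of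
-- f₁(n₁) f₂(n₂) ... f_r(n_r)
nested : List (ℕ → ℚ) → ℕ → ℕ → ℚ
nested []       lo ub = 1ℚ
nested (f ∷ fs) lo ub = sumQ (map (λ n → f n * nested fs lo n) (range lo ub))

zetaStarTo : List ℕ → ℕ → ℚ
zetaStarTo ks M = nested (map (λ k n → inv (n ℕ.^ k)) ks) 1 M

lhsTo : ℕ → ℕ → ℚ
lhsTo s N = nested (replicate s (λ n → inv (n ℕ.* (n ∸ 1))) ++ (inv ∷ [])) 2 N

prodTo : ℕ → ℚ
prodTo M = prodQ (map (λ l → invQ (1ℚ - (+ 2 / 1) * inv (l ℕ.* (l ∸ 1)))) (range 3 M))

rhsTo : ℕ → ℕ → ℚ
rhsTo s M = inv (2 ℕ.^ suc s) * prodTo M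
          + zetaStarTo (replicate s 2 ++ (1 ∷ [])) M
          - zetaStarTo (replicate s 2) M

{-# OPTIONS --safe #-}
module Submission where

-- Split off the chains with n_{s+1} = 2.  On the remaining chains all indices are ≥ 3, and
-- lowering every index by one only enlarges each factor (1/(n(n-1)) ≤ 1/(n-1)², 1/n ≤ 1/(n-1));
-- the result is the sum over chains with last index ≥ 2, i.e. ζ*({2}^s,1) − ζ*({2}^s).
-- The chains ending in 2 contribute  (1/2) Σ ∏ 1/(n_i(n_i-1)) = 2^{-(s+1)} Σ ∏ c(n_i)  with
-- c(l) = 2/(l(l-1)).  As c(2) = 1, this sum is Σ_{j ≤ s} h_j(c(3), c(4), …), a partial sum of the
-- complete homogeneous sums h_j, which are the coefficients of ∏_{l ≥ 3} 1/(1 - c(l)).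
-- All of this holds for the truncations at a common bound M ≥ 2, and the truncated left-hand side
-- grows with its bound, so taking M ≥ N + 2 needs no ε at all.

open import Defs
open import Data.Nat as ℕ using (ℕ; zero; suc; _∸_; _≥_; s≤s; z≤n; _≤′_; ≤′-refl; ≤′-step)
import Data.Nat.Properties as ℕP
open import Data.Integer as ℤ using (+_)
import Data.Integer.Properties as ℤP
open import Data.Rational as ℚ using (ℚ; 0ℚ; 1ℚ; _+_; _*_; _-_; _/_; _≤_; _<_; Positive; toℚᵘ)
import Data.Rational.Properties as ℚP
open import Data.Rational.Solver using (module +-*-Solver)
open import Data.Rational.Unnormalised as ℚᵘ using (mkℚᵘ; _≃_; *≤*)
import Data.Rational.Unnormalised.Properties as ℚᵘP
open import Data.List using (List; []; _∷_; _∷ʳ_; map; upTo; applyUpTo; replicate)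
import Data.List.Properties as ListP
open import Data.List.Relation.Unary.All as All using (All; []; _∷_)
import Data.List.Relation.Unary.All.Properties as AllP
open import Data.List.Relation.Binary.Pointwise as Pointwise using (Pointwise; []; _∷_)
open import Data.Product using (Σ; _,_)
open import Function using (_∘_)
open import Relation.Binary.PropositionalEquality
open import Relation.Nullary using (yes; no)
open import Relation.Nullary.Decidable using (toWitness)
open import Relation.Nullary.Negation using (contradiction)

toℚᵘ-inv : ∀ k → toℚᵘ (inv (suc k)) ≃ mkℚᵘ (+ 1) k
toℚᵘ-inv k = ℚP.toℚᵘ-fromℚᵘ (mkℚᵘ (+ 1) k)

inv-nonneg : ∀ n → 0ℚ ≤ inv n
inv-nonneg zero    = ℚP.≤-refl
inv-nonneg (suc k) =
  ℚP.toℚᵘ-cancel-≤ (ℚᵘP.≤-respʳ-≃ (ℚᵘP.≃-sym (toℚᵘ-inv k)) (*≤* (ℤ.+≤+ z≤n)))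

inv-antitone : ∀ {m n} → 1 ℕ.≤ m → m ℕ.≤ n → inv n ≤ inv m
inv-antitone {suc j} {suc k} _ m≤n = ℚP.toℚᵘ-cancel-≤
  (ℚᵘP.≤-respˡ-≃ (ℚᵘP.≃-sym (toℚᵘ-inv k)) (ℚᵘP.≤-respʳ-≃ (ℚᵘP.≃-sym (toℚᵘ-inv j))
    (*≤* (ℤP.*-monoˡ-≤-nonNeg (+ 1) (ℤ.+≤+ m≤n)))))

inv-* : ∀ m n → inv (m ℕ.* n) ≡ inv m * inv n
inv-* zero    n       = sym (ℚP.*-zeroˡ (inv n))
inv-* (suc m) zero    = trans (cong inv (ℕP.*-zeroʳ m)) (sym (ℚP.*-zeroʳ (inv (suc m))))
inv-* (suc m) (suc n) = ℚP.toℚᵘ-injective (begin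
  toℚᵘ (inv (suc m ℕ.* suc n))                ≈⟨ toℚᵘ-inv (n ℕ.+ m ℕ.* suc n) ⟩
  mkℚᵘ (+ 1) m ℚᵘ.* mkℚᵘ (+ 1) n              ≈⟨ ℚᵘP.*-cong (ℚᵘP.≃-sym (toℚᵘ-inv m))
                                                              (ℚᵘP.≃-sym (toℚᵘ-inv n)) ⟩
  toℚᵘ (inv (suc m)) ℚᵘ.* toℚᵘ (inv (suc n))  ≈⟨ ℚᵘP.≃-sym (ℚP.toℚᵘ-homo-* (inv (suc m)) (inv (suc n))) ⟩
  toℚᵘ (inv (suc m) * inv (suc n))            ∎)
  where open ℚᵘP.≃-Reasoning

inv-inverseˡ : ∀ k → inv (suc k) * (+ suc k / 1) ≡ 1ℚ
inv-inverseˡ k = ℚP.toℚᵘ-injective (begin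
  toℚᵘ (inv (suc k) * (+ suc k / 1))          ≈⟨ ℚP.toℚᵘ-homo-* (inv (suc k)) (+ suc k / 1) ⟩
  toℚᵘ (inv (suc k)) ℚᵘ.* toℚᵘ (+ suc k / 1)  ≈⟨ ℚᵘP.*-cong (toℚᵘ-inv k) (ℚP.toℚᵘ-fromℚᵘ n) ⟩
  ℚᵘ.1/ n ℚᵘ.* n                              ≈⟨ ℚᵘP.*-inverseˡ n ⟩
  ℚᵘ.1ℚᵘ                                      ∎)
  where
  open ℚᵘP.≃-Reasoning
  n = mkℚᵘ (+ suc k) 0

inv-*-cancelˡ : ∀ k m → inv (suc k ℕ.* m) * (+ suc k / 1) ≡ inv m
inv-*-cancelˡ k m = begin
  inv (suc k ℕ.* m) * κ        ≡⟨ cong (_* κ) (inv-* (suc k) m) ⟩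
  inv (suc k) * inv m * κ      ≡⟨ solve 3 (λ x y z → x :* y :* z := y :* (x :* z)) refl (inv (suc k)) (inv m) κ ⟩
  inv m * (inv (suc k) * κ)    ≡⟨ cong (inv m *_) (inv-inverseˡ k) ⟩
  inv m * 1ℚ                   ≡⟨ ℚP.*-identityʳ (inv m) ⟩
  inv m                        ∎
  where
  open ≡-Reasoning
  open +-*-Solver
  κ = + suc k / 1

*-nonneg : ∀ {p q} → 0ℚ ≤ p → 0ℚ ≤ q → 0ℚ ≤ p * q
*-nonneg {p} {q} 0≤p 0≤q =
  ℚP.nonNegative⁻¹ _ {{ℚP.nonNeg*nonNeg⇒nonNeg p {{ℚ.nonNegative 0≤p}} q {{ℚ.nonNegative 0≤q}}}}

*-mono-≤-nonneg : ∀ {p q r s} → 0ℚ ≤ p → 0ℚ ≤ s → p ≤ q → r ≤ s → p * r ≤ q * s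
*-mono-≤-nonneg {p} {q} {r} {s} 0≤p 0≤s p≤q r≤s = ℚP.≤-trans
  (ℚP.*-monoˡ-≤-nonNeg p {{ℚ.nonNegative 0≤p}} r≤s)
  (ℚP.*-monoʳ-≤-nonNeg s {{ℚ.nonNegative 0≤s}} p≤q)

p≤p+q : ∀ p {q} → 0ℚ ≤ q → p ≤ p + q
p≤p+q p 0≤q = ℚP.≤-trans (ℚP.≤-reflexive (sym (ℚP.+-identityʳ p))) (ℚP.+-monoʳ-≤ p 0≤q)

0<1-p : ∀ {p} → p < 1ℚ → 0ℚ < 1ℚ - p
0<1-p p<1 = ℚP.+-monoʳ-< 1ℚ (ℚP.neg-antimono-< p<1)

invQ-inverseʳ : ∀ {p} → 0ℚ < p → p * invQ p ≡ 1ℚ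
invQ-inverseʳ {p} 0<p with p ℚP.≟ 0ℚ
... | yes refl = contradiction 0<p (ℚP.<-irrefl refl)
... | no p≢0   = ℚP.*-inverseʳ p {{ℚ.≢-nonZero p≢0}}

invQ-nonneg : ∀ {p} → 0ℚ < p → 0ℚ ≤ invQ p
invQ-nonneg {p} 0<p with p ℚP.≟ 0ℚ
... | yes refl = ℚP.≤-refl
... | no p≢0   = ℚP.<⇒≤ (ℚP.positive⁻¹ _ {{ℚP.1/pos⇒pos p {{ℚ.positive 0<p}}}})

monotone-by-steps : (a : ℕ → ℚ) → (∀ n → a n ≤ a (suc n)) → ∀ {m n} → m ℕ.≤ n → a m ≤ a n
monotone-by-steps a step {m} m≤n = go (ℕP.≤⇒≤′ m≤n)
  where
  go : ∀ {n} → m ≤′ n → a m ≤ a n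
  go ≤′-refl        = ℚP.≤-refl
  go (≤′-step m≤′n) = ℚP.≤-trans (go m≤′n) (step _)

downward-induction : ∀ {p} (P : ℕ → Set p) N → (∀ lo → N ℕ.< lo → P lo) →
                     (∀ lo → lo ℕ.≤ N → P (suc lo) → P lo) → ∀ lo → P lo
downward-induction P N beyond step lo = go (suc N) lo (ℕP.m≤m+n (suc N) lo)
  where
  go : ∀ k lo → N ℕ.< k ℕ.+ lo → P lo
  go zero    lo N<lo   = beyond lo N<lo
  go (suc k) lo N<k+lo with lo ℕP.≤? N
  ... | yes lo≤N = step lo lo≤N (go k (suc lo) (subst (N ℕ.<_) (sym (ℕP.+-suc k lo)) N<k+lo))
  ... | no  lo≰N = beyond lo (ℕP.≰⇒> lo≰N)

range-nil : ∀ {lo ub} → ub ℕ.< lo → range lo ub ≡ []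
range-nil {lo} ub<lo = cong (map (lo ℕ.+_) ∘ upTo) (ℕP.m≤n⇒m∸n≡0 ub<lo)

range-cons : ∀ {lo ub} → lo ℕ.≤ ub → range lo ub ≡ lo ∷ range (suc lo) ub
range-cons {lo} {ub} lo≤ub = begin
  map (lo ℕ.+_) (upTo (suc ub ∸ lo))          ≡⟨ cong (map (lo ℕ.+_) ∘ upTo) (ℕP.+-∸-assoc 1 lo≤ub) ⟩
  lo ℕ.+ 0 ∷ map (lo ℕ.+_) (applyUpTo suc k)  ≡⟨ cong₂ _∷_ (ℕP.+-identityʳ lo)
                                                       (cong (map (lo ℕ.+_)) (sym (ListP.map-upTo suc k))) ⟩
  lo ∷ map (lo ℕ.+_) (map suc (upTo k))       ≡⟨ cong (lo ∷_) (sym (ListP.map-∘ (upTo k))) ⟩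
  lo ∷ map ((lo ℕ.+_) ∘ suc) (upTo k)         ≡⟨ cong (lo ∷_) (ListP.map-cong (ℕP.+-suc lo) (upTo k)) ⟩
  lo ∷ range (suc lo) ub                      ∎
  where
  open ≡-Reasoning
  k = ub ∸ lo

range-∷ʳ : ∀ {lo ub} → lo ℕ.≤ suc ub → range lo (suc ub) ≡ range lo ub ∷ʳ suc ub
range-∷ʳ {lo} {ub} lo≤1+ub = begin
  map (lo ℕ.+_) (upTo (suc (suc ub) ∸ lo))  ≡⟨ cong (map (lo ℕ.+_) ∘ upTo) (ℕP.+-∸-assoc 1 lo≤1+ub) ⟩
  map (lo ℕ.+_) (upTo (suc k))              ≡⟨ cong (map (lo ℕ.+_)) (sym (ListP.upTo-∷ʳ k)) ⟩
  map (lo ℕ.+_) (upTo k ∷ʳ k)               ≡⟨ ListP.map-++ (lo ℕ.+_) (upTo k) (k ∷ []) ⟩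
  range lo ub ∷ʳ (lo ℕ.+ k)                 ≡⟨ cong (range lo ub ∷ʳ_) (ℕP.m+[n∸m]≡n lo≤1+ub) ⟩
  range lo ub ∷ʳ suc ub                     ∎
  where
  open ≡-Reasoning
  k = suc ub ∸ lo

range-suc : ∀ lo ub → range (suc lo) (suc ub) ≡ map suc (range lo ub)
range-suc lo ub = ListP.map-∘ (upTo (suc ub ∸ lo))

range-lower : ∀ lo ub → All (lo ℕ.≤_) (range lo ub)
range-lower lo ub = AllP.map⁺ (All.universal (ℕP.m≤m+n lo) (upTo (suc ub ∸ lo)))

sumQ-∷ʳ : ∀ xs x → sumQ (xs ∷ʳ x) ≡ sumQ xs + x
sumQ-∷ʳ []       x = trans (ℚP.+-identityʳ x) (sym (ℚP.+-identityˡ x))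
sumQ-∷ʳ (y ∷ xs) x = trans (cong (λ t → y + t) (sumQ-∷ʳ xs x)) (sym (ℚP.+-assoc y (sumQ xs) x))

sumQ-map-+ : ∀ (f g : ℕ → ℚ) xs →
             sumQ (map (λ x → f x + g x) xs) ≡ sumQ (map f xs) + sumQ (map g xs)
sumQ-map-+ f g []       = refl
sumQ-map-+ f g (x ∷ xs) = trans (cong (λ t → f x + g x + t) (sumQ-map-+ f g xs))
  (solve 4 (λ a b c d → (a :+ b) :+ (c :+ d) := (a :+ c) :+ (b :+ d)) refl
     (f x) (g x) (sumQ (map f xs)) (sumQ (map g xs)))
  where open +-*-Solver

sumQ-map-* : ∀ c (f : ℕ → ℚ) xs → sumQ (map (λ x → c * f x) xs) ≡ c * sumQ (map f xs)
sumQ-map-* c f []       = sym (ℚP.*-zeroʳ c)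
sumQ-map-* c f (x ∷ xs) =
  trans (cong (λ t → c * f x + t) (sumQ-map-* c f xs)) (sym (ℚP.*-distribˡ-+ c (f x) _))

sumQ-map-mono : ∀ {f g : ℕ → ℚ} {xs} → All (λ x → f x ≤ g x) xs → sumQ (map f xs) ≤ sumQ (map g xs)
sumQ-map-mono []           = ℚP.≤-refl
sumQ-map-mono (fx≤gx ∷ ps) = ℚP.+-mono-≤ fx≤gx (sumQ-map-mono ps)

sumQ-nonneg : ∀ {xs} → All (0ℚ ≤_) xs → 0ℚ ≤ sumQ xs
sumQ-nonneg []           = ℚP.≤-refl
sumQ-nonneg (0≤x ∷ 0≤xs) = ℚP.+-mono-≤ 0≤x (sumQ-nonneg 0≤xs)

prodQ-nonneg : ∀ {xs} → All (0ℚ ≤_) xs → 0ℚ ≤ prodQ xs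
prodQ-nonneg []           = ℚP.nonNegative⁻¹ 1ℚ
prodQ-nonneg (0≤x ∷ 0≤xs) = *-nonneg 0≤x (prodQ-nonneg 0≤xs)

replicate-suc-∷ʳ : ∀ {A : Set} s (x : A) → replicate (suc s) x ≡ replicate s x ∷ʳ x
replicate-suc-∷ʳ zero    x = refl
replicate-suc-∷ʳ (suc s) x = cong (x ∷_) (replicate-suc-∷ʳ s x)

Nonnegative : (ℕ → ℚ) → Set
Nonnegative f = ∀ n → 0ℚ ≤ f n

nested-nonneg : ∀ {fs} → All Nonnegative fs → ∀ lo ub → 0ℚ ≤ nested fs lo ub
nested-nonneg []           lo ub = ℚP.nonNegative⁻¹ 1ℚ
nested-nonneg (f≥0 ∷ fs≥0) lo ub = sumQ-nonneg (AllP.map⁺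
  (All.universal (λ n → *-nonneg (f≥0 n) (nested-nonneg fs≥0 lo n)) (range lo ub)))

nested-∷ʳ-empty : ∀ fs g {lo ub} → ub ℕ.< lo → nested (fs ∷ʳ g) lo ub ≡ 0ℚ
nested-∷ʳ-empty []       g ub<lo = cong (sumQ ∘ map _) (range-nil ub<lo)
nested-∷ʳ-empty (f ∷ fs) g ub<lo = cong (sumQ ∘ map _) (range-nil ub<lo)

nested-split : ∀ fs g {lo ub} → lo ℕ.≤ ub →
               nested (fs ∷ʳ g) lo ub ≡ g lo * nested fs lo ub + nested (fs ∷ʳ g) (suc lo) ub
nested-split []       g lo≤ub = cong (sumQ ∘ map (λ n → g n * 1ℚ)) (range-cons lo≤ub)
nested-split (f ∷ fs) g {lo} {ub} lo≤ub = begin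
  sumQ (map (λ n → f n * nested (fs ∷ʳ g) lo n) (range lo ub))
    ≡⟨ cong sumQ (ListP.map-cong-local (All.map termwise (range-lower lo ub))) ⟩
  sumQ (map (λ n → g lo * lower n + upper n) (range lo ub))
    ≡⟨ sumQ-map-+ (λ n → g lo * lower n) upper (range lo ub) ⟩
  sumQ (map (λ n → g lo * lower n) (range lo ub)) + sumQ (map upper (range lo ub))
    ≡⟨ cong₂ _+_ (sumQ-map-* (g lo) lower (range lo ub)) drop-lo ⟩
  g lo * nested (f ∷ fs) lo ub + nested (f ∷ fs ∷ʳ g) (suc lo) ub
    ∎
  where
  open ≡-Reasoning
  open +-*-Solver
  lower upper : ℕ → ℚ
  lower n = f n * nested fs lo n
  upper n = f n * nested (fs ∷ʳ g) (suc lo) n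
  termwise : ∀ {n} → lo ℕ.≤ n → f n * nested (fs ∷ʳ g) lo n ≡ g lo * lower n + upper n
  termwise {n} lo≤n = begin
    f n * nested (fs ∷ʳ g) lo n
      ≡⟨ cong (f n *_) (nested-split fs g lo≤n) ⟩
    f n * (g lo * nested fs lo n + nested (fs ∷ʳ g) (suc lo) n)
      ≡⟨ solve 4 (λ x y z w → x :* (y :* z :+ w) := y :* (x :* z) :+ x :* w)
           refl (f n) (g lo) (nested fs lo n) (nested (fs ∷ʳ g) (suc lo) n) ⟩
    g lo * lower n + upper n
      ∎
  drop-lo : sumQ (map upper (range lo ub)) ≡ nested (f ∷ fs ∷ʳ g) (suc lo) ub
  drop-lo = begin
    sumQ (map upper (range lo ub))              ≡⟨ cong (sumQ ∘ map upper) (range-cons lo≤ub) ⟩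
    f lo * nested (fs ∷ʳ g) (suc lo) lo + rest  ≡⟨ cong (λ t → f lo * t + rest)
                                                      (nested-∷ʳ-empty fs g (ℕP.n<1+n lo)) ⟩
    f lo * 0ℚ + rest                            ≡⟨ solve 2 (λ x y → x :* con 0ℚ :+ y := y) refl (f lo) rest ⟩
    rest                                        ∎
    where rest = nested (f ∷ fs ∷ʳ g) (suc lo) ub

nested-mono-suc : ∀ {fs} → All Nonnegative fs → ∀ lo ub → nested fs lo ub ≤ nested fs lo (suc ub)
nested-mono-suc []                     lo ub = ℚP.≤-refl
nested-mono-suc {f ∷ fs} (f≥0 ∷ fs≥0) lo ub with lo ℕP.≤? suc ub
... | yes lo≤1+ub = begin
  sumQ (map term (range lo ub))                   ≤⟨ p≤p+q _ (*-nonneg (f≥0 (suc ub)) (nested-nonneg fs≥0 lo (suc ub))) ⟩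
  sumQ (map term (range lo ub)) + term (suc ub)   ≡⟨ sym (sumQ-∷ʳ (map term (range lo ub)) (term (suc ub))) ⟩
  sumQ (map term (range lo ub) ∷ʳ term (suc ub))  ≡⟨ cong sumQ (sym (ListP.map-++ term (range lo ub) (suc ub ∷ []))) ⟩
  sumQ (map term (range lo ub ∷ʳ suc ub))         ≡⟨ cong (sumQ ∘ map term) (sym (range-∷ʳ lo≤1+ub)) ⟩
  sumQ (map term (range lo (suc ub)))             ∎
  where
  open ℚP.≤-Reasoning
  term : ℕ → ℚ
  term n = f n * nested fs lo n
... | no lo≰1+ub = ℚP.≤-reflexive (trans
  (cong (sumQ ∘ map _) (range-nil (ℕP.<-trans (ℕP.n<1+n ub) (ℕP.≰⇒> lo≰1+ub))))
  (sym (cong (sumQ ∘ map _) (range-nil (ℕP.≰⇒> lo≰1+ub)))))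

nested-mono : ∀ {fs} → All Nonnegative fs → ∀ lo {ub ub′} → ub ℕ.≤ ub′ → nested fs lo ub ≤ nested fs lo ub′
nested-mono {fs} fs≥0 lo = monotone-by-steps (nested fs lo) (nested-mono-suc fs≥0 lo)

ShiftsBelow : ℕ → (ℕ → ℚ) → (ℕ → ℚ) → Set
ShiftsBelow lo f g = ∀ n → lo ℕ.≤ n → f (suc n) ≤ g n

nested-shift : ∀ {lo fs gs} → Pointwise (ShiftsBelow lo) fs gs →
               All Nonnegative fs → All Nonnegative gs →
               ∀ ub → nested fs (suc lo) (suc ub) ≤ nested gs lo ub
nested-shift []                  _            _           ub = ℚP.≤-refl
nested-shift {lo} {f ∷ fs} {g ∷ gs} (f≤g ∷ fs≤gs) (f≥0 ∷ fs≥0) (_ ∷ gs≥0) ub = begin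
  sumQ (map (λ n → f n * nested fs (suc lo) n) (range (suc lo) (suc ub)))
    ≡⟨ cong (sumQ ∘ map _) (range-suc lo ub) ⟩
  sumQ (map (λ n → f n * nested fs (suc lo) n) (map suc (range lo ub)))
    ≡⟨ cong sumQ (sym (ListP.map-∘ (range lo ub))) ⟩
  sumQ (map (λ n → f (suc n) * nested fs (suc lo) (suc n)) (range lo ub))
    ≤⟨ sumQ-map-mono (All.map termwise (range-lower lo ub)) ⟩
  sumQ (map (λ n → g n * nested gs lo n) (range lo ub))
    ∎
  where
  open ℚP.≤-Reasoning
  termwise : ∀ {n} → lo ℕ.≤ n → f (suc n) * nested fs (suc lo) (suc n) ≤ g n * nested gs lo n
  termwise {n} lo≤n = *-mono-≤-nonneg (f≥0 (suc n)) (nested-nonneg gs≥0 lo n)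
                                      (f≤g n lo≤n) (nested-shift fs≤gs fs≥0 gs≥0 n)

nested-replicate-scale : ∀ k (f : ℕ → ℚ) s lo ub →
  inv (suc k ℕ.^ s) * nested (replicate s (λ n → (+ suc k / 1) * f n)) lo ub ≡ nested (replicate s f) lo ub
nested-replicate-scale k f zero    lo ub = refl
nested-replicate-scale k f (suc s) lo ub = begin
  inv (suc k ℕ.* m) * sumQ (map (λ n → (κ * f n) * scaled n) (range lo ub))
    ≡⟨ sym (sumQ-map-* (inv (suc k ℕ.* m)) (λ n → (κ * f n) * scaled n) (range lo ub)) ⟩
  sumQ (map (λ n → inv (suc k ℕ.* m) * ((κ * f n) * scaled n)) (range lo ub))
    ≡⟨ cong sumQ (ListP.map-cong termwise (range lo ub)) ⟩
  sumQ (map (λ n → f n * nested (replicate s f) lo n) (range lo ub))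
    ∎
  where
  open ≡-Reasoning
  open +-*-Solver
  m = suc k ℕ.^ s
  κ = + suc k / 1
  scaled : ℕ → ℚ
  scaled = nested (replicate s (λ n → κ * f n)) lo
  termwise : ∀ n → inv (suc k ℕ.* m) * ((κ * f n) * scaled n) ≡ f n * nested (replicate s f) lo n
  termwise n = begin
    inv (suc k ℕ.* m) * ((κ * f n) * scaled n)  ≡⟨ solve 4 (λ i x y z → i :* ((x :* y) :* z) := y :* ((i :* x) :* z))
                                                      refl (inv (suc k ℕ.* m)) κ (f n) (scaled n) ⟩
    f n * ((inv (suc k ℕ.* m) * κ) * scaled n)  ≡⟨ cong (λ t → f n * (t * scaled n)) (inv-*-cancelˡ k m) ⟩
    f n * (inv m * scaled n)                    ≡⟨ cong (f n *_) (nested-replicate-scale k f s lo n) ⟩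
    f n * nested (replicate s f) lo n           ∎

-- h s lo is the complete homogeneous symmetric polynomial h_s(c lo, …, c N), hSum s lo is
-- Σ_{j < s} h_j, and eulerProduct lo is ∏_{l = lo}^{N} 1/(1 - c l), whose expansion is Σ_j h_j.
module CompleteHomogeneous (c : ℕ → ℚ) (N : ℕ) where

  h : ℕ → ℕ → ℚ
  h s lo = nested (replicate s c) lo N

  hSum : ℕ → ℕ → ℚ
  hSum zero    lo = 0ℚ
  hSum (suc s) lo = hSum s lo + h s lo

  eulerProduct : ℕ → ℚ
  eulerProduct lo = prodQ (map (λ l → invQ (1ℚ - c l)) (range lo N))

  h-split : ∀ s {lo} → lo ℕ.≤ N → h (suc s) lo ≡ c lo * h s lo + h (suc s) (suc lo)
  h-split s {lo} lo≤N = begin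
    nested (replicate (suc s) c) lo N                       ≡⟨ cong (λ fs → nested fs lo N) (replicate-suc-∷ʳ s c) ⟩
    nested (replicate s c ∷ʳ c) lo N                        ≡⟨ nested-split (replicate s c) c lo≤N ⟩
    c lo * h s lo + nested (replicate s c ∷ʳ c) (suc lo) N  ≡⟨ cong (λ fs → c lo * h s lo + nested fs (suc lo) N)
                                                                    (sym (replicate-suc-∷ʳ s c)) ⟩
    c lo * h s lo + h (suc s) (suc lo)                      ∎
    where open ≡-Reasoning

  h-beyond : ∀ s {lo} → N ℕ.< lo → h (suc s) lo ≡ 0ℚ
  h-beyond s {lo} N<lo = trans (cong (λ fs → nested fs lo N) (replicate-suc-∷ʳ s c))
                               (nested-∷ʳ-empty (replicate s c) c N<lo)

  hSum-split : ∀ s {lo} → lo ℕ.≤ N → hSum (suc s) lo ≡ c lo * hSum s lo + hSum (suc s) (suc lo)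
  hSum-split zero    {lo} lo≤N =
    solve 1 (λ x → con 0ℚ :+ con 1ℚ := x :* con 0ℚ :+ (con 0ℚ :+ con 1ℚ)) refl (c lo)
    where open +-*-Solver
  hSum-split (suc s) {lo} lo≤N = begin
    hSum (suc s) lo + h (suc s) lo
      ≡⟨ cong₂ _+_ (hSum-split s lo≤N) (h-split s lo≤N) ⟩
    (c lo * hSum s lo + hSum (suc s) (suc lo)) + (c lo * h s lo + h (suc s) (suc lo))
      ≡⟨ solve 5 (λ x a b u v → (x :* a :+ b) :+ (x :* u :+ v) := x :* (a :+ u) :+ (b :+ v)) refl
           (c lo) (hSum s lo) (hSum (suc s) (suc lo)) (h s lo) (h (suc s) (suc lo)) ⟩
    c lo * hSum (suc s) lo + hSum (suc (suc s)) (suc lo)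
      ∎
    where
    open ≡-Reasoning
    open +-*-Solver

  hSum-beyond : ∀ s {lo} → N ℕ.< lo → hSum (suc s) lo ≡ 1ℚ
  hSum-beyond zero    N<lo = refl
  hSum-beyond (suc s) N<lo = cong₂ _+_ (hSum-beyond s N<lo) (h-beyond s N<lo)

  -- With weight 1 at lo, the indices equal to lo cost nothing, so h_s collapses to Σ_{j ≤ s} h_j above lo.
  h-unit : ∀ {lo} → c lo ≡ 1ℚ → lo ℕ.≤ N → ∀ s → h s lo ≡ hSum (suc s) (suc lo)
  h-unit c≡1 lo≤N zero    = refl
  h-unit {lo} c≡1 lo≤N (suc s) = begin
    h (suc s) lo                                     ≡⟨ h-split s lo≤N ⟩
    c lo * h s lo + h (suc s) (suc lo)               ≡⟨ cong₂ (λ x y → x * y + h (suc s) (suc lo))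
                                                               c≡1 (h-unit c≡1 lo≤N s) ⟩
    1ℚ * hSum (suc s) (suc lo) + h (suc s) (suc lo)  ≡⟨ cong (_+ h (suc s) (suc lo))
                                                             (ℚP.*-identityˡ (hSum (suc s) (suc lo))) ⟩
    hSum (suc (suc s)) (suc lo)                      ∎
    where open ≡-Reasoning

  hSum≤eulerProduct : ∀ {lo₀} → (∀ l → 0ℚ ≤ c l) → (∀ {l} → lo₀ ℕ.≤ l → c l < 1ℚ) →
                      ∀ s lo → lo₀ ℕ.≤ lo → hSum s lo ≤ eulerProduct lo
  hSum≤eulerProduct {lo₀} c≥0 c<1 zero lo lo₀≤lo = prodQ-nonneg (AllP.map⁺
    (All.map (λ lo≤l → invQ-nonneg (0<1-p (c<1 (ℕP.≤-trans lo₀≤lo lo≤l)))) (range-lower lo N)))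
  hSum≤eulerProduct {lo₀} c≥0 c<1 (suc s) =
    downward-induction (λ lo → lo₀ ℕ.≤ lo → hSum (suc s) lo ≤ eulerProduct lo) N beyond step
    where
    open ℚP.≤-Reasoning
    E = eulerProduct
    beyond : ∀ lo → N ℕ.< lo → lo₀ ℕ.≤ lo → hSum (suc s) lo ≤ E lo
    beyond lo N<lo _ = ℚP.≤-reflexive (trans (hSum-beyond s N<lo) (sym (cong (prodQ ∘ map _) (range-nil N<lo))))
    step : ∀ lo → lo ℕ.≤ N → (lo₀ ℕ.≤ suc lo → hSum (suc s) (suc lo) ≤ E (suc lo)) →
           lo₀ ℕ.≤ lo → hSum (suc s) lo ≤ E lo
    step lo lo≤N ih lo₀≤lo = begin
      hSum (suc s) lo                           ≡⟨ hSum-split s lo≤N ⟩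
      c lo * hSum s lo + hSum (suc s) (suc lo)  ≤⟨ ℚP.+-mono-≤ (ℚP.*-monoˡ-≤-nonNeg (c lo) {{ℚ.nonNegative (c≥0 lo)}}
                                                                   (hSum≤eulerProduct c≥0 c<1 s lo lo₀≤lo))
                                                              (ih (ℕP.m≤n⇒m≤1+n lo₀≤lo)) ⟩
      c lo * E lo + E (suc lo)                  ≡⟨ cong (λ t → c lo * t + E (suc lo)) E-cons ⟩
      c lo * (q * E (suc lo)) + E (suc lo)      ≡⟨ cong (λ t → c lo * (q * E (suc lo)) + t)
                                                        (sym (trans (cong (_* E (suc lo)) q-inverse) (ℚP.*-identityˡ _))) ⟩
      c lo * (q * E (suc lo)) + (1ℚ - c lo) * q * E (suc lo)
                                                ≡⟨ solve 3 (λ x y z → x :* (y :* z) :+ (con 1ℚ :- x) :* y :* z := y :* z)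
                                                     refl (c lo) q (E (suc lo)) ⟩
      q * E (suc lo)                            ≡⟨ sym E-cons ⟩
      E lo                                      ∎
      where
      open +-*-Solver
      q = invQ (1ℚ - c lo)
      E-cons : E lo ≡ q * E (suc lo)
      E-cons = cong (prodQ ∘ map _) (range-cons lo≤N)
      q-inverse : (1ℚ - c lo) * q ≡ 1ℚ
      q-inverse = invQ-inverseʳ (0<1-p (c<1 lo₀≤lo))

invPronic : ℕ → ℚ
invPronic n = inv (n ℕ.* (n ∸ 1))

invPow : ℕ → ℕ → ℚ
invPow k n = inv (n ℕ.^ k)

twiceInvPronic : ℕ → ℚ
twiceInvPronic n = (+ 2 / 1) * invPronic n

twiceInvPronic-nonneg : ∀ l → 0ℚ ≤ twiceInvPronic l
twiceInvPronic-nonneg l = *-nonneg (ℚP.nonNegative⁻¹ (+ 2 / 1)) (inv-nonneg (l ℕ.* (l ∸ 1)))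

twiceInvPronic<1 : ∀ {l} → 3 ℕ.≤ l → twiceInvPronic l < 1ℚ
twiceInvPronic<1 3≤l = ℚP.≤-<-trans
  (ℚP.*-monoˡ-≤-nonNeg (+ 2 / 1) (inv-antitone (s≤s z≤n) (ℕP.*-mono-≤ 3≤l (ℕP.∸-monoˡ-≤ 1 3≤l))))
  (toWitness {a? = twiceInvPronic 3 ℚP.<? 1ℚ} _)

invPronic-shift : ∀ {n} → 1 ℕ.≤ n → invPronic (suc n) ≤ invPow 2 n
invPronic-shift {n} 1≤n = inv-antitone (ℕP.*-mono-≤ 1≤n 1≤n*1)
  (ℕP.≤-trans (ℕP.≤-reflexive (cong (n ℕ.*_) (ℕP.*-identityʳ n))) (ℕP.m≤n+m (n ℕ.* n) n))
  where
  1≤n*1 : 1 ℕ.≤ n ℕ.* 1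
  1≤n*1 = subst (1 ℕ.≤_) (sym (ℕP.*-identityʳ n)) 1≤n

inv-shift : ∀ {n} → 1 ℕ.≤ n → inv (suc n) ≤ invPow 1 n
inv-shift {n} 1≤n = inv-antitone (subst (1 ℕ.≤_) (sym (ℕP.*-identityʳ n)) 1≤n)
  (ℕP.≤-trans (ℕP.≤-reflexive (ℕP.*-identityʳ n)) (ℕP.n≤1+n n))

lhsWeights : ℕ → List (ℕ → ℚ)
lhsWeights s = replicate s invPronic ∷ʳ inv

tailWeights : ℕ → List (ℕ → ℚ)
tailWeights s = replicate s (invPow 2) ∷ʳ invPow 1

zetaStarTail : ℕ → ℕ → ℚ
zetaStarTail s M = nested (tailWeights s) 2 M

lhsWeights-nonneg : ∀ s → All Nonnegative (lhsWeights s)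
lhsWeights-nonneg s = AllP.∷ʳ⁺ (AllP.replicate⁺ s (λ n → inv-nonneg (n ℕ.* (n ∸ 1)))) inv-nonneg

tailWeights-nonneg : ∀ s → All Nonnegative (tailWeights s)
tailWeights-nonneg s = AllP.∷ʳ⁺ (AllP.replicate⁺ s (λ n → inv-nonneg (n ℕ.^ 2))) (λ n → inv-nonneg (n ℕ.^ 1))

lhsWeights-shift : ∀ s → Pointwise (ShiftsBelow 2) (lhsWeights s) (tailWeights s)
lhsWeights-shift s = Pointwise.++⁺
  (Pointwise.replicate⁺ (λ n 2≤n → invPronic-shift (1≤ 2≤n)) s) ((λ n 2≤n → inv-shift (1≤ 2≤n)) ∷ [])
  where
  1≤ : ∀ {n} → 2 ℕ.≤ n → 1 ℕ.≤ n
  1≤ = ℕP.≤-trans (s≤s z≤n)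

rhsTo≡prodTo+zetaStarTail : ∀ s {M} → 1 ℕ.≤ M → rhsTo s M ≡ inv (2 ℕ.^ suc s) * prodTo M + zetaStarTail s M
rhsTo≡prodTo+zetaStarTail s {M} 1≤M = begin
  A + zetaStarTo (replicate s 2 ∷ʳ 1) M - zetaStarTo (replicate s 2) M
    ≡⟨ cong₂ (λ x y → A + x - y) split-at-1 (cong (λ fs → nested fs 1 M) (ListP.map-replicate invPow s 2)) ⟩
  A + (1ℚ * Z + zetaStarTail s M) - Z
    ≡⟨ solve 3 (λ a z t → a :+ (con 1ℚ :* z :+ t) :- z := a :+ t) refl A Z (zetaStarTail s M) ⟩
  A + zetaStarTail s M
    ∎
  where
  open ≡-Reasoning
  open +-*-Solver
  A = inv (2 ℕ.^ suc s) * prodTo M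
  Z = nested (replicate s (invPow 2)) 1 M
  split-at-1 : zetaStarTo (replicate s 2 ∷ʳ 1) M ≡ 1ℚ * Z + zetaStarTail s M
  split-at-1 = trans
    (cong (λ fs → nested fs 1 M) (trans (ListP.map-++ invPow (replicate s 2) (1 ∷ []))
                                        (cong (_∷ʳ invPow 1) (ListP.map-replicate invPow s 2))))
    (nested-split (replicate s (invPow 2)) (invPow 1) 1≤M)

lhsTo≤rhsTo : ∀ s {M} → 2 ℕ.≤ M → lhsTo s M ≤ rhsTo s M
lhsTo≤rhsTo s {M} 2≤M = begin
  lhsTo s M
    ≡⟨ nested-split (replicate s invPronic) inv 2≤M ⟩
  inv 2 * nested (replicate s invPronic) 2 M + nested (lhsWeights s) 3 M
    ≤⟨ ℚP.+-mono-≤ ending-in-2 above-2 ⟩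
  inv (2 ℕ.^ suc s) * prodTo M + zetaStarTail s M
    ≡⟨ sym (rhsTo≡prodTo+zetaStarTail s (ℕP.≤-trans (s≤s z≤n) 2≤M)) ⟩
  rhsTo s M
    ∎
  where
  open ℚP.≤-Reasoning
  open CompleteHomogeneous twiceInvPronic M
  ending-in-2 : inv 2 * nested (replicate s invPronic) 2 M ≤ inv (2 ℕ.^ suc s) * prodTo M
  ending-in-2 = begin
    inv 2 * nested (replicate s invPronic) 2 M  ≡⟨ cong (inv 2 *_) (sym (nested-replicate-scale 1 invPronic s 2 M)) ⟩
    inv 2 * (inv (2 ℕ.^ s) * h s 2)             ≡⟨ sym (ℚP.*-assoc (inv 2) (inv (2 ℕ.^ s)) (h s 2)) ⟩
    inv 2 * inv (2 ℕ.^ s) * h s 2               ≡⟨ cong (_* h s 2) (sym (inv-* 2 (2 ℕ.^ s))) ⟩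
    inv (2 ℕ.^ suc s) * h s 2                   ≡⟨ cong (inv (2 ℕ.^ suc s) *_) (h-unit refl 2≤M s) ⟩
    inv (2 ℕ.^ suc s) * hSum (suc s) 3          ≤⟨ ℚP.*-monoˡ-≤-nonNeg (inv (2 ℕ.^ suc s))
                                                       {{ℚ.nonNegative (inv-nonneg (2 ℕ.^ suc s))}}
                                                       (hSum≤eulerProduct twiceInvPronic-nonneg twiceInvPronic<1
                                                                          (suc s) 3 ℕP.≤-refl) ⟩
    inv (2 ℕ.^ suc s) * eulerProduct 3          ∎
  above-2 : nested (lhsWeights s) 3 M ≤ zetaStarTail s M
  above-2 = ℚP.≤-trans (nested-mono (lhsWeights-nonneg s) 3 (ℕP.n≤1+n M))
                       (nested-shift (lhsWeights-shift s) (lhsWeights-nonneg s) (tailWeights-nonneg s) M)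

lemma4p1 : (s : ℕ) → s ≥ 1 → (N : ℕ) → (ε : ℚ) → Positive ε →
    Σ ℕ (λ M₀ → (M : ℕ) → M ≥ M₀ → lhsTo s N ≤ rhsTo s M + ε)
lemma4p1 s _ N ε ε>0 = 2 ℕ.+ N , λ M M≥2+N → begin
  lhsTo s N      ≤⟨ nested-mono (lhsWeights-nonneg s) 2 (ℕP.≤-trans (ℕP.m≤n+m N 2) M≥2+N) ⟩
  lhsTo s M      ≤⟨ lhsTo≤rhsTo s (ℕP.≤-trans (ℕP.m≤m+n 2 N) M≥2+N) ⟩
  rhsTo s M      ≤⟨ p≤p+q (rhsTo s M) (ℚP.<⇒≤ (ℚP.positive⁻¹ ε {{ε>0}})) ⟩
  rhsTo s M + ε  ∎
  where open ℚP.≤-Reasoning
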